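{- Let $G$ be a graph with a total order $\prec$ on $V(G)$ and a function $\beta:V(G)\to\{1,2\}$. If $u,v,w\in V(G)$ satisfy $u\neq v$ and $\{u,v\}\prec w$, then $\delta(u,v)\leq \delta(u,w)+\delta(v,w)-2\beta(w)+2$. Moreover, if $G$ is bipartite, then $\delta(u,v)+\delta(u,w)+\delta(v,w)$ is either an even number or $\infty$.
   Context: A walk $Q=x_1,\ldots,x_r$ has length $|Q|=r-1$ and $\lambda(Q)=|Q|-2\sum_{i=2}^{r-1}(\beta(x_i)-1)$. For sets, $X\prec Y$ means $x\prec y$ for all $x\in X,y\in Y$. Looping walks are defined recursively: a walk $x_1,\ldots,x_r$ is looping if $x_1\neq x_r$ and, when $r\geq 3$, (i) $\{x_1,x_r\}\prec\{x_2,\ldots,x_{r-1}\}$ and (ii) there is $\ell\notin\{1,r\}$ such that both $x_1,\ldots,x_\ell$ and $x_\ell,\ldots,x_r$ are looping walks (for $r=2$, a looping walk is two distinct adjacent vertices). $\delta(u,v)$ is the minimum of $\lambda(Q)$ over looping walks with endpoints $u,v$ (in either order), $\infty$ if none exists; arithmetic with $\infty$ follows the usual conventions ($\infty + a = \infty$). -}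

module Defs where

open import Data.Nat using (ℕ)
open import Data.Fin using (Fin)
open import Data.Bool using (Bool)
open import Data.Integer as ℤ using (ℤ; _-_; +_)
open import Data.Integer.Divisibility using () renaming (_∣_ to _∣ℤ_)
open import Data.List using (List; []; _∷_; _++_; [_]; length; map)
open import Data.Nat.ListAction using (sum)
open import Data.Unit using (⊤)
open import Data.List.Relation.Unary.All using (All)
open import Data.Product using (Σ; _×_; _,_)
open import Data.Sum using (_⊎_)
open import Data.Empty using (⊥)
open import Relation.Nullary using (¬_)
open import Relation.Binary.PropositionalEquality using (_≡_; _≢_)

data ℤ∞ : Set where
  fin : ℤ → ℤ∞
  ∞   : ℤ∞

infixl 6 _+∞_ _+∞ℤ_
_+∞_ : ℤ∞ → ℤ∞ → ℤ∞
fin a +∞ fin b = fin (a ℤ.+ b)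
fin a +∞ ∞     = ∞
∞     +∞ _     = ∞

_+∞ℤ_ : ℤ∞ → ℤ → ℤ∞
fin a +∞ℤ k = fin (a ℤ.+ k)
∞     +∞ℤ k = ∞

infix 4 _≤∞_
data _≤∞_ : ℤ∞ → ℤ∞ → Set where
  fin≤fin : ∀ {a b} → a ℤ.≤ b → fin a ≤∞ fin b
  _≤∞∞    : ∀ x → x ≤∞ ∞

EvenOr∞ : ℤ∞ → Set
EvenOr∞ (fin k) = (+ 2) ∣ℤ k
EvenOr∞ ∞       = ⊤

SimpleGraph : ℕ → Set₁
SimpleGraph n = Σ (Fin n → Fin n → Set) λ Adj →
  (∀ x y → Adj x y → Adj y x) × (∀ x → ¬ Adj x x)

Bipartite : ∀ {n} → (Fin n → Fin n → Set) → Set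
Bipartite {n} Adj = Σ (Fin n → Bool) λ c → ∀ x y → Adj x y → c x ≢ c y

module _ {n : ℕ} (Adj : Fin n → Fin n → Set) (_≺_ : Fin n → Fin n → Set)
         (β : Fin n → ℕ) where

  -- Looping x ms y : the walk x, ms₁, …, msₖ, y is a looping walk.
  data Looping : Fin n → List (Fin n) → Fin n → Set where
    base : ∀ {x y} → x ≢ y → Adj x y → Looping x [] y
    step : ∀ {x y z ms₁ ms₂} → x ≢ y →
           All (λ m → (x ≺ m) × (y ≺ m)) (ms₁ ++ z ∷ ms₂) →
           Looping x ms₁ z → Looping z ms₂ y →
           Looping x (ms₁ ++ z ∷ ms₂) y

  lam : List (Fin n) → ℤ
  lam ms = + (length ms Data.Nat.+ 1) - (+ 2) ℤ.* + sum (map (λ m → β m Data.Nat.∸ 1) ms)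

  LoopingBetween : Fin n → Fin n → List (Fin n) → Set
  LoopingBetween u v ms = Looping u ms v ⊎ Looping v ms u

  IsDelta : Fin n → Fin n → ℤ∞ → Set
  IsDelta u v d =
      ((d ≡ ∞) × (∀ ms → ¬ LoopingBetween u v ms))
    ⊎ Σ ℤ λ k → (d ≡ fin k)
        × (Σ (List (Fin n)) λ ms → LoopingBetween u v ms × lam ms ≡ k)
        × (∀ ms → LoopingBetween u v ms → k ℤ.≤ lam ms)

-- Concatenating a looping walk from u to w with one from w to v gives a looping
-- walk from u to v (the interiors stay above u and v because u, v ≺ w), whose λ is
-- the sum of the two λ's minus 2(β(w) − 1), the correction for the new interior
-- vertex w.  Minimising over both halves gives the inequality.  For the parity
-- statement, a proper 2-colouring c forces λ(Q) ≡ |Q| ≡ c(x) + c(y) (mod 2) for a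
-- walk Q from x to y, so the three values of δ add up to 2(c(u) + c(v) + c(w))
-- modulo 2.
module Submission where

open import Defs
open import Data.Bool using (Bool; true; false)
open import Data.Empty using (⊥-elim)
open import Data.Fin using (Fin)
open import Data.Integer using (ℤ; +_; -_; _+_; _*_)
import Data.Integer as ℤ
import Data.Integer.Properties as ℤ
open import Data.Integer.Divisibility.Signed
  using (∣⇒∣ᵤ; ∣m∣n⇒∣m+n; ∣m+n∣n⇒∣m; ∣n⇒∣m*n; ∣-refl)
  renaming (_∣_ to _∣ₛ_)
open import Data.Integer.Tactic.RingSolver using (solve-∀)
open import Data.List using (List; []; _∷_; _++_; [_]; length; map; reverse)
open import Data.List.Properties
  using (length-++; map-++; length-reverse; reverse-++; unfold-reverse; ++-assoc)
open import Data.List.Relation.Unary.All as All using (All; []; _∷_)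
open import Data.List.Relation.Unary.All.Properties using (++⁺)
open import Data.List.Relation.Binary.Permutation.Propositional using (↭-sym)
open import Data.List.Relation.Binary.Permutation.Propositional.Properties
  using (↭-reverse; All-resp-↭; map⁺)
open import Data.Nat using (ℕ)
import Data.Nat as ℕ
open import Data.Nat.ListAction using (sum)
open import Data.Nat.ListAction.Properties using (sum-++; sum-↭)
open import Data.Nat.Tactic.RingSolver using () renaming (solve-∀ to ℕ-solve-∀)
open import Data.Product using (Σ; _×_; _,_; proj₁; swap)
open import Data.Sum using (_⊎_; inj₁; inj₂) renaming (swap to ⊎-swap)
open import Data.Unit using (tt)
open import Function using (_∘_)
open import Relation.Binary.Definitions using (Symmetric; Transitive)
open import Relation.Binary.PropositionalEquality
  using (_≡_; _≢_; refl; sym; trans; cong; cong₂; subst; module ≡-Reasoning)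
open import Relation.Binary.Structures using (IsStrictTotalOrder)

reverse-++-∷ : ∀ {A : Set} (xs : List A) z ys →
               reverse (xs ++ z ∷ ys) ≡ reverse ys ++ z ∷ reverse xs
reverse-++-∷ xs z ys = begin
  reverse (xs ++ z ∷ ys)             ≡⟨ reverse-++ xs (z ∷ ys) ⟩
  reverse (z ∷ ys) ++ reverse xs     ≡⟨ cong (_++ reverse xs) (unfold-reverse z ys) ⟩
  (reverse ys ++ [ z ]) ++ reverse xs ≡⟨ ++-assoc (reverse ys) [ z ] (reverse xs) ⟩
  reverse ys ++ z ∷ reverse xs        ∎
  where open ≡-Reasoning

-2[n∸1]≡-2n+2 : ∀ {n} → 1 ℕ.≤ n → - (+ 2 * + (n ℕ.∸ 1)) ≡ - (+ 2 * + n) + + 2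
-2[n∸1]≡-2n+2 {ℕ.suc n} _ = identity (+ n)
  where
  identity : ∀ a → - (+ 2 * a) ≡ - (+ 2 * (+ 1 + a)) + + 2
  identity = solve-∀

bit : Bool → ℤ
bit true  = + 1
bit false = + 0

2∣1+bit+bit : ∀ {a b} → a ≢ b → + 2 ∣ₛ + 1 + bit a + bit b
2∣1+bit+bit {true}  {true}  a≢b = ⊥-elim (a≢b refl)
2∣1+bit+bit {true}  {false} _   = ∣-refl
2∣1+bit+bit {false} {true}  _   = ∣-refl
2∣1+bit+bit {false} {false} a≢b = ⊥-elim (a≢b refl)

module _ {n : ℕ} (Adj : Fin n → Fin n → Set) (_≺_ : Fin n → Fin n → Set)
         (β : Fin n → ℕ) where

  private
    L : Fin n → List (Fin n) → Fin n → Set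
    L = Looping Adj _≺_ β
    λ′ : List (Fin n) → ℤ
    λ′ = lam Adj _≺_ β
    excess : List (Fin n) → ℕ
    excess ms = sum (map (λ m → β m ℕ.∸ 1) ms)

  lam-++-∷ : ∀ ms₁ z ms₂ →
             λ′ (ms₁ ++ z ∷ ms₂) ≡ λ′ ms₁ + λ′ ms₂ ℤ.- + 2 * + (β z ℕ.∸ 1)
  lam-++-∷ ms₁ z ms₂ = begin
    + (length (ms₁ ++ z ∷ ms₂) ℕ.+ 1) ℤ.- + 2 * + excess (ms₁ ++ z ∷ ms₂)
      ≡⟨ cong₂ (λ l s → + l ℤ.- + 2 * + s) length-splits excess-splits ⟩
    + ((l₁ ℕ.+ 1) ℕ.+ (l₂ ℕ.+ 1)) ℤ.- + 2 * + (s₁ ℕ.+ (e ℕ.+ s₂))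
      ≡⟨ cong₂ (λ a b → a ℤ.- + 2 * b)
               (ℤ.pos-+ (l₁ ℕ.+ 1) (l₂ ℕ.+ 1))
               (trans (ℤ.pos-+ s₁ (e ℕ.+ s₂)) (cong (_+_ (+ s₁)) (ℤ.pos-+ e s₂))) ⟩
    (+ (l₁ ℕ.+ 1) + + (l₂ ℕ.+ 1)) ℤ.- + 2 * (+ s₁ + (+ e + + s₂))
      ≡⟨ regroup (+ (l₁ ℕ.+ 1)) (+ (l₂ ℕ.+ 1)) (+ s₁) (+ e) (+ s₂) ⟩
    λ′ ms₁ + λ′ ms₂ ℤ.- + 2 * + e ∎
    where
    open ≡-Reasoning
    l₁ l₂ s₁ s₂ e : ℕ
    l₁ = length ms₁
    l₂ = length ms₂
    s₁ = excess ms₁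
    s₂ = excess ms₂
    e = β z ℕ.∸ 1
    length-splits : length (ms₁ ++ z ∷ ms₂) ℕ.+ 1 ≡ (l₁ ℕ.+ 1) ℕ.+ (l₂ ℕ.+ 1)
    length-splits = trans (cong (ℕ._+ 1) (length-++ ms₁)) (shuffle l₁ l₂)
      where
      shuffle : ∀ a b → a ℕ.+ ℕ.suc b ℕ.+ 1 ≡ (a ℕ.+ 1) ℕ.+ (b ℕ.+ 1)
      shuffle = ℕ-solve-∀
    excess-splits : excess (ms₁ ++ z ∷ ms₂) ≡ s₁ ℕ.+ (e ℕ.+ s₂)
    excess-splits = trans (cong sum (map-++ _ ms₁ (z ∷ ms₂))) (sum-++ (map _ ms₁) _)
    regroup : ∀ a b s e t → (a + b) ℤ.- + 2 * (s + (e + t))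
                          ≡ (a ℤ.- + 2 * s) + (b ℤ.- + 2 * t) ℤ.- + 2 * e
    regroup = solve-∀

  lam-reverse : ∀ ms → λ′ (reverse ms) ≡ λ′ ms
  lam-reverse ms = cong₂ (λ l s → + (l ℕ.+ 1) ℤ.- + 2 * + s)
    (length-reverse ms) (sum-↭ (map⁺ _ (↭-reverse ms)))

  Looping-interior : ∀ {x ms y} → L x ms y → All (λ m → (x ≺ m) × (y ≺ m)) ms
  Looping-interior (base _ _)       = []
  Looping-interior (step _ ms≻ _ _) = ms≻

  Looping-reverse : Symmetric Adj → ∀ {x ms y} → L x ms y → L y (reverse ms) x
  Looping-reverse sym-Adj (base x≢y xy) = base (x≢y ∘ sym) (sym-Adj xy)
  Looping-reverse sym-Adj (step {x} {y} {z} {ms₁} {ms₂} x≢y ms≻ p q) =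
    subst (λ ms → L y ms x) (sym (reverse-++-∷ ms₁ z ms₂))
      (step (x≢y ∘ sym) reversed-interior
            (Looping-reverse sym-Adj q) (Looping-reverse sym-Adj p))
    where
    reversed-interior : All (λ m → (y ≺ m) × (x ≺ m)) (reverse ms₂ ++ z ∷ reverse ms₁)
    reversed-interior = subst (All _) (reverse-++-∷ ms₁ z ms₂)
      (All-resp-↭ (↭-sym (↭-reverse (ms₁ ++ z ∷ ms₂))) (All.map swap ms≻))

  LoopingBetween⇒Looping : Symmetric Adj → ∀ {x y ms} → LoopingBetween Adj _≺_ β x y ms →
                           Σ (List (Fin n)) λ ms′ → L x ms′ y × λ′ ms′ ≡ λ′ ms
  LoopingBetween⇒Looping _       {ms = ms} (inj₁ p) = ms , p , refl
  LoopingBetween⇒Looping sym-Adj {ms = ms} (inj₂ p) =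
    reverse ms , Looping-reverse sym-Adj p , lam-reverse ms

  Looping-join : Transitive _≺_ → ∀ {u v w ms₁ ms₂} → u ≢ v → u ≺ w → v ≺ w →
                 L u ms₁ w → L w ms₂ v → L u (ms₁ ++ w ∷ ms₂) v
  Looping-join <-trans u≢v u≺w v≺w p q = step u≢v
    (++⁺ (All.map (λ (u≺m , w≺m) → u≺m , <-trans v≺w w≺m) (Looping-interior p))
         ((u≺w , v≺w) ∷ All.map (λ (w≺m , v≺m) → <-trans u≺w w≺m , v≺m) (Looping-interior q)))
    p q

  δ-attained : ∀ {u v k} → IsDelta Adj _≺_ β u v (fin k) →
               Σ (List (Fin n)) λ ms → LoopingBetween Adj _≺_ β u v ms × λ′ ms ≡ k
  δ-attained (inj₁ (() , _))
  δ-attained (inj₂ (_ , refl , attained , _)) = attained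

  δ-≤-lam : ∀ {u v d ms} → IsDelta Adj _≺_ β u v d → LoopingBetween Adj _≺_ β u v ms →
            d ≤∞ fin (λ′ ms)
  δ-≤-lam (inj₁ (refl , none))        Q = ⊥-elim (none _ Q)
  δ-≤-lam (inj₂ (_ , refl , _ , min)) Q = fin≤fin (min _ Q)

  δ-triangle : Symmetric Adj → Transitive _≺_ → ∀ {u v w duv duw dvw} →
               u ≢ v → u ≺ w → v ≺ w →
               IsDelta Adj _≺_ β u v duv → IsDelta Adj _≺_ β u w duw →
               IsDelta Adj _≺_ β v w dvw →
               duv ≤∞ (duw +∞ dvw) +∞ℤ - (+ 2 * + (β w ℕ.∸ 1))
  δ-triangle _ _ {duv = duv} {duw = ∞} _ _ _ _ _ _ = duv ≤∞∞
  δ-triangle _ _ {duv = duv} {duw = fin _} {dvw = ∞} _ _ _ _ _ _ = duv ≤∞∞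
  δ-triangle sym-Adj <-trans {w = w} {duw = fin _} {dvw = fin _} u≢v u≺w v≺w Duv Duw Dvw
    with δ-attained Duw | δ-attained Dvw
  ... | ms₁ , Q₁ , refl | ms₂ , Q₂ , refl
    with LoopingBetween⇒Looping sym-Adj Q₁ | LoopingBetween⇒Looping sym-Adj (⊎-swap Q₂)
  ... | ms₁′ , p , p≗Q₁ | ms₂′ , q , q≗Q₂ =
    subst (λ k → _ ≤∞ fin k) lam-joined
      (δ-≤-lam Duv (inj₁ (Looping-join <-trans u≢v u≺w v≺w p q)))
    where
    lam-joined : λ′ (ms₁′ ++ w ∷ ms₂′) ≡ λ′ ms₁ + λ′ ms₂ ℤ.- + 2 * + (β w ℕ.∸ 1)
    lam-joined = trans (lam-++-∷ ms₁′ w ms₂′)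
      (cong (ℤ._- + 2 * + (β w ℕ.∸ 1)) (cong₂ _+_ p≗Q₁ q≗Q₂))

  module _ (c : Fin n → Bool) (proper : ∀ x y → Adj x y → c x ≢ c y) where

    Looping-parity : ∀ {x ms y} → L x ms y → + 2 ∣ₛ λ′ ms + bit (c x) + bit (c y)
    Looping-parity (base _ xy) = 2∣1+bit+bit (proper _ _ xy)
    Looping-parity {x} {y = y} (step {z = z} {ms₁} {ms₂} _ _ p q) =
      subst (+ 2 ∣ₛ_) (sym split)
        (∣m∣n⇒∣m+n (∣m∣n⇒∣m+n (Looping-parity p) (Looping-parity q))
                  (∣n⇒∣m*n (- (+ (β z ℕ.∸ 1) + bit (c z))) ∣-refl))
      where
      split : λ′ (ms₁ ++ z ∷ ms₂) + bit (c x) + bit (c y)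
            ≡ (λ′ ms₁ + bit (c x) + bit (c z)) + (λ′ ms₂ + bit (c z) + bit (c y))
              + (- (+ (β z ℕ.∸ 1) + bit (c z))) * + 2
      split = trans (cong (λ l → l + bit (c x) + bit (c y)) (lam-++-∷ ms₁ z ms₂))
                    (regroup (λ′ ms₁) (λ′ ms₂) (+ (β z ℕ.∸ 1)) (bit (c x)) (bit (c y)) (bit (c z)))
        where
        regroup : ∀ l₁ l₂ e a b d → l₁ + l₂ ℤ.- + 2 * e + a + b
                                  ≡ (l₁ + a + d) + (l₂ + d + b) + (- (e + d)) * + 2
        regroup = solve-∀

    LoopingBetween-parity : Symmetric Adj → ∀ {x y ms} → LoopingBetween Adj _≺_ β x y ms →
                            + 2 ∣ₛ λ′ ms + bit (c x) + bit (c y)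
    LoopingBetween-parity sym-Adj Q with LoopingBetween⇒Looping sym-Adj Q
    ... | _ , p , p≗Q = subst (λ l → + 2 ∣ₛ l + _ + _) p≗Q (Looping-parity p)

  δ-sum-even : Symmetric Adj → Bipartite Adj → ∀ {u v w duv duw dvw} →
               IsDelta Adj _≺_ β u v duv → IsDelta Adj _≺_ β u w duw →
               IsDelta Adj _≺_ β v w dvw → EvenOr∞ ((duv +∞ duw) +∞ dvw)
  δ-sum-even _ _ {duv = ∞} _ _ _ = tt
  δ-sum-even _ _ {duv = fin _} {duw = ∞} _ _ _ = tt
  δ-sum-even _ _ {duv = fin _} {duw = fin _} {dvw = ∞} _ _ _ = tt
  δ-sum-even sym-Adj (c , proper) {u} {v} {w} {fin _} {fin _} {fin _} Duv Duw Dvw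
    with δ-attained Duv | δ-attained Duw | δ-attained Dvw
  ... | ms₁ , Q₁ , refl | ms₂ , Q₂ , refl | ms₃ , Q₃ , refl =
    ∣⇒∣ᵤ (∣m+n∣n⇒∣m {m = λ′ ms₁ + λ′ ms₂ + λ′ ms₃} sum+twice-bits-even
                    (∣n⇒∣m*n (bit (c u) + bit (c v) + bit (c w)) ∣-refl))
    where
    parity : ∀ {x y ms} → LoopingBetween Adj _≺_ β x y ms → + 2 ∣ₛ λ′ ms + bit (c x) + bit (c y)
    parity = LoopingBetween-parity c proper sym-Adj
    regroup : ∀ l₁ l₂ l₃ a b d → (l₁ + a + b) + (l₂ + a + d) + (l₃ + b + d)
                               ≡ (l₁ + l₂ + l₃) + (a + b + d) * + 2
    regroup = solve-∀
    sum+twice-bits-even : + 2 ∣ₛ (λ′ ms₁ + λ′ ms₂ + λ′ ms₃) + (bit (c u) + bit (c v) + bit (c w)) * + 2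
    sum+twice-bits-even =
      subst (+ 2 ∣ₛ_) (regroup (λ′ ms₁) (λ′ ms₂) (λ′ ms₃) (bit (c u)) (bit (c v)) (bit (c w)))
        (∣m∣n⇒∣m+n (∣m∣n⇒∣m+n (parity Q₁) (parity Q₂)) (parity Q₃))

lemma21 : ∀ {n : ℕ} (G : SimpleGraph n) (_≺_ : Fin n → Fin n → Set)
    → IsStrictTotalOrder _≡_ _≺_
    → (β : Fin n → ℕ) → (∀ x → (β x ≡ 1) ⊎ (β x ≡ 2))
    → (u v w : Fin n) → u ≢ v → (u ≺ w) × (v ≺ w)
    → (duv duw dvw : ℤ∞)
    → IsDelta (proj₁ G) _≺_ β u v duv
    → IsDelta (proj₁ G) _≺_ β u w duw
    → IsDelta (proj₁ G) _≺_ β v w dvw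
    → (duv ≤∞ ((duw +∞ dvw) +∞ℤ ((- ((+ 2) * (+ β w))) + (+ 2))))
      × (Bipartite (proj₁ G) → EvenOr∞ ((duv +∞ duw) +∞ dvw))
lemma21 (Adj , sym-Adj , _) _≺_ ≺-sto β β∈12 u v w u≢v (u≺w , v≺w) duv duw dvw Duv Duw Dvw =
  subst (λ k → duv ≤∞ (duw +∞ dvw) +∞ℤ k) (-2[n∸1]≡-2n+2 β-positive)
    (δ-triangle Adj _≺_ β (sym-Adj _ _) (IsStrictTotalOrder.trans ≺-sto) u≢v u≺w v≺w Duv Duw Dvw)
  , λ bipartite → δ-sum-even Adj _≺_ β (sym-Adj _ _) bipartite Duv Duw Dvw
  where
  β-positive : 1 ℕ.≤ β w
  β-positive with β∈12 w
  ... | inj₁ β≡1 rewrite β≡1 = ℕ.s≤s ℕ.z≤n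
  ... | inj₂ β≡2 rewrite β≡2 = ℕ.s≤s ℕ.z≤n
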